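{- Let $n \ge 2$. In No-more-than-half-delete Nim with $n$ heaps, the position $\langle z_1, z_2, \ldots, z_n \rangle$ (with $z_1,\ldots,z_n$ positive integers) is a $\mathcal{P}$-position if and only if: (i) when $n$ is even, $v_2(z_1)=v_2(z_2)=\cdots=v_2(z_n)=0$ (i.e., every $z_i$ is odd); (ii) when $n$ is odd, $v_2(z_1)=v_2(z_2)=\cdots=v_2(z_n)$.
   Context: For a positive integer $z$, $v_2(z)$ denotes the $2$-adic valuation of $z$, i.e., the exponent of the largest power of $2$ dividing $z$. No-more-than-half-delete Nim with $n$ heaps: a position is an $n$-tuple $\langle z_1,\ldots,z_n\rangle$ of positive integers (heap sizes). Two players alternate moves. A move consists of choosing a positive integer $k \le n/2$, selecting $k$ heaps and deleting them, and then selecting $k$ of the remaining $n-k$ heaps and splitting each of them into two heaps, each containing at least one token (so the number of heaps stays $n$). Normal play convention: a player who cannot move loses. A $\mathcal{P}$-position is a position from which the player about to move has no winning strategy. -}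

module Defs where

open import Data.Nat using (ℕ; zero; suc; _+_; _*_; _^_; _≤_; _<_)
open import Data.Nat.Divisibility using (_∣_)
open import Data.List using (List; []; _∷_; _++_; length)
open import Data.List.Relation.Binary.Permutation.Propositional using (_↭_)
open import Data.Product using (Σ; ∃; _×_; _,_)
open import Relation.Binary.PropositionalEquality using (_≡_)
open import Relation.Nullary using (¬_)

V2 : ℕ → ℕ → Set
V2 z k = (2 ^ k ∣ z) × ¬ (2 ^ suc k ∣ z)

data Splits : List ℕ → List ℕ → Set where
  []  : Splits [] []
  _∷_ : ∀ {a b xs ys} → (1 ≤ a) × (1 ≤ b) → Splits xs ys →
        Splits (a + b ∷ xs) (a ∷ b ∷ ys)

-- A position is a list of heap sizes (order of heaps is immaterial; the
-- new position is taken up to permutation).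
record Move (p q : List ℕ) : Set where
  field
    k       : ℕ
    k≥1     : 1 ≤ k
    k≤half  : 2 * k ≤ length p
    D S R T : List ℕ
    p-split : p ↭ (D ++ S ++ R)
    lenD    : length D ≡ k
    lenS    : length S ≡ k
    splitST : Splits S T
    q-form  : q ↭ (R ++ T)

data Win (p : List ℕ) : Set where
  win : (q : List ℕ) → Move p q → (∀ r → Move q r → Win r) → Win p

PPosition : List ℕ → Set
PPosition p = ¬ Win p

{-# OPTIONS --safe #-}
-- Let G be the set of positions whose heaps all have valuation 0 (n even), or all have one
-- common valuation (n odd). No move leads from G to G: a heap of valuation t cannot be
-- split into two heaps a, b of valuation t, as then a + b has valuation above t; and the
-- common valuation cannot change, trivially for n even and because some heap is untouched
-- for n odd.
-- From outside G there is a move into G: with t the least valuation (t = 0 for n even),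
-- pair up the heaps divisible by 2^(t+1), deleting one heap of each pair and splitting the
-- other x as 2^t + (x - 2^t); an unpaired such heap is split after deleting a heap of
-- valuation t, which exists by minimality for n odd and by parity for n even. Since every
-- move decreases the number of tokens, G is exactly the set of P-positions.
module Submission where

open import Defs
open import Data.Empty using (⊥-elim)
open import Data.Nat
  using (ℕ; zero; suc; _+_; _*_; _∸_; _^_; _≤_; _<_; _≤?_; z≤n; s≤s; z<s; >-nonZero)
open import Data.Nat.Properties
open import Data.Nat.Divisibility
open import Data.Nat.DivMod using (_%_; m%n<n; %-distribˡ-+)
open import Data.Nat.Induction using (<-wellFounded)
open import Data.Nat.ListAction using (sum)
open import Data.Nat.ListAction.Properties using (sum-↭; sum-++)
open import Data.List using (List; []; _∷_; _++_; length)
open import Data.List.Properties using (length-++)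
open import Data.List.Relation.Unary.All using (All; []; _∷_; all?) renaming (map to All-map)
open import Data.List.Relation.Unary.All.Properties using (++⁺; ++⁻ˡ; ++⁻ʳ)
open import Data.List.Relation.Unary.Any using (Any; here; there)
open import Data.List.Relation.Binary.Permutation.Propositional
  using (_↭_; ↭-refl; ↭-sym; ↭-trans; prep; swap)
open import Data.List.Relation.Binary.Permutation.Propositional.Properties
  using (All-resp-↭; Any-resp-↭; ↭-length; shift)
open import Data.Product using (∃; ∃₂; _×_; _,_; proj₁; proj₂)
open import Data.Sum using (_⊎_; inj₁; inj₂) renaming (map to ⊎-map)
open import Function.Bundles using (_⇔_; mk⇔)
open import Induction.WellFounded using (Acc; acc)
open import Relation.Nullary using (¬_; Dec; yes; no)
open import Relation.Nullary.Decidable using (_×-dec_; ¬?; decidable-stable)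
open import Relation.Binary.PropositionalEquality
  using (_≡_; refl; sym; trans; cong; cong₂; subst; module ≡-Reasoning)

^-monoʳ-∣ : ∀ m {a b} → a ≤ b → m ^ a ∣ m ^ b
^-monoʳ-∣ m {b = b} z≤n = 1∣ (m ^ b)
^-monoʳ-∣ m (s≤s a≤b) = *-monoʳ-∣ m (^-monoʳ-∣ m a≤b)

2^n<2^[1+n] : ∀ n → 2 ^ n < 2 ^ suc n
2^n<2^[1+n] n = ^-monoʳ-< 2 (n<1+n 1) (n<1+n n)

odd⇒%2≡1 : ∀ {i} → ¬ 2 ∣ i → i % 2 ≡ 1
odd⇒%2≡1 {i} 2∤i with i % 2 in eq | m%n<n i 2
... | 0           | _               = ⊥-elim (2∤i (m%n≡0⇒n∣m i 2 eq))
... | 1           | _               = refl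
... | suc (suc _) | s≤s (s≤s ())

odd+odd-even : ∀ {i j} → ¬ 2 ∣ i → ¬ 2 ∣ j → 2 ∣ i + j
odd+odd-even {i} {j} 2∤i 2∤j = m%n≡0⇒n∣m (i + j) 2 (begin
  (i + j) % 2           ≡⟨ %-distribˡ-+ i j 2 ⟩
  (i % 2 + j % 2) % 2   ≡⟨ cong₂ (λ a b → (a + b) % 2) (odd⇒%2≡1 2∤i) (odd⇒%2≡1 2∤j) ⟩
  0                     ∎)
  where open ≡-Reasoning

AllV2 : ℕ → List ℕ → Set
AllV2 t = All (λ z → V2 z t)

V2? : ∀ z t → Dec (V2 z t)
V2? z t = (2 ^ t ∣? z) ×-dec ¬? (2 ^ suc t ∣? z)

V2-maximal : ∀ {z s t} → V2 z t → 2 ^ s ∣ z → s ≤ t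
V2-maximal {s = s} {t} (_ , 2^[1+t]∤z) 2^s∣z with s ≤? t
... | yes s≤t = s≤t
... | no  s≰t = ⊥-elim (2^[1+t]∤z (∣-trans (^-monoʳ-∣ 2 (≰⇒> s≰t)) 2^s∣z))

V2-unique : ∀ {z s t} → V2 z s → V2 z t → s ≡ t
V2-unique vs vt = ≤-antisym (V2-maximal vt (proj₁ vs)) (V2-maximal vs (proj₁ vt))

V2⇒>0 : ∀ {z t} → V2 z t → 0 < z
V2⇒>0 {zero}  (_ , ∤0) = ⊥-elim (∤0 (_ ∣0))
V2⇒>0 {suc _} _        = z<s

V2-pow : ∀ t → V2 (2 ^ t) t
V2-pow t = ∣-refl , λ d → <⇒≱ (2^n<2^[1+n] t) (∣⇒≤ {{m^n≢0 2 t}} d)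

V2-double : ∀ {w t} → V2 w t → V2 (2 * w) (suc t)
V2-double (2^t∣w , 2^[1+t]∤w) = *-monoʳ-∣ 2 2^t∣w , λ d → 2^[1+t]∤w (*-cancelˡ-∣ 2 d)

V2⇒odd-cofactor : ∀ {z t} → V2 z t → ∃ λ i → z ≡ i * 2 ^ t × ¬ 2 ∣ i
V2⇒odd-cofactor {t = t} (divides i z≡i*2^t , 2^[1+t]∤z) =
  i , z≡i*2^t ,
  λ 2∣i → 2^[1+t]∤z (subst (2 ^ suc t ∣_) (sym z≡i*2^t) (*-monoˡ-∣ (2 ^ t) 2∣i))

V2-+ : ∀ {a b t} → V2 a t → V2 b t → 2 ^ suc t ∣ a + b
V2-+ {t = t} va vb with V2⇒odd-cofactor {t = t} va | V2⇒odd-cofactor {t = t} vb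
... | i , refl , 2∤i | j , refl , 2∤j =
  subst (2 ^ suc t ∣_) (*-distribʳ-+ (2 ^ t) i j) (*-monoˡ-∣ (2 ^ t) (odd+odd-even 2∤i 2∤j))

V2-complement : ∀ {a b t} → V2 a t → 2 ^ suc t ∣ a + b → V2 b t
V2-complement {a} {b} {t} (2^t∣a , 2^[1+t]∤a) 2^[1+t]∣a+b =
  ∣m+n∣m⇒∣n (∣-trans (n∣m*n 2) 2^[1+t]∣a+b) 2^t∣a ,
  λ 2^[1+t]∣b →
    2^[1+t]∤a (∣m+n∣m⇒∣n (subst (2 ^ suc t ∣_) (+-comm a b) 2^[1+t]∣a+b) 2^[1+t]∣b)

v2-exists : ∀ {z} → 0 < z → ∃ (V2 z)
v2-exists = go (<-wellFounded _)
  where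
  go : ∀ {z} → Acc _<_ z → 0 < z → ∃ (V2 z)
  go {z} (acc smaller) z>0 with 2 ∣? z
  ... | no  2∤z = 0 , 1∣ z , 2∤z
  ... | yes (divides w@(suc _) refl) with go (smaller (m<m*n w 2 (n<1+n 1))) z<s
  ...   | t , vw = suc t , subst (λ z → V2 z (suc t)) (*-comm 2 w) (V2-double {t = t} vw)

record High (t x : ℕ) : Set where
  constructor high
  field
    divisible : 2 ^ suc t ∣ x
    positive  : 0 < x

High⇒¬V2 : ∀ {t x} → High t x → ¬ V2 x t
High⇒¬V2 (high 2^[1+t]∣x _) (_ , 2^[1+t]∤x) = 2^[1+t]∤x 2^[1+t]∣x

split-High : ∀ {t x} → High t x → ∃₂ λ a b → x ≡ a + b × V2 a t × V2 b t
split-High {t} {x} (high 2^[1+t]∣x x>0) =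
  2 ^ t , x ∸ 2 ^ t , sym x≡ , V2-pow t ,
  V2-complement {t = t} (V2-pow t) (subst (2 ^ suc t ∣_) (sym x≡) 2^[1+t]∣x)
  where
  x≡ : 2 ^ t + (x ∸ 2 ^ t) ≡ x
  x≡ = m+[n∸m]≡n (<⇒≤ (<-≤-trans (2^n<2^[1+n] t) (∣⇒≤ {{>-nonZero x>0}} 2^[1+t]∣x)))

Position : ℕ → List ℕ → Set
Position n p = All (0 <_) p × length p ≡ n

length-arrangement : ∀ {p D S R : List ℕ} {k} → p ↭ D ++ S ++ R → length D ≡ k → length S ≡ k →
                     length p ≡ k + (k + length R)
length-arrangement {p} {D} {S} {R} {k} arr lenD lenS =
  begin
    length p                            ≡⟨ ↭-length arr ⟩
    length (D ++ S ++ R)                ≡⟨ length-++ D {S ++ R} ⟩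
    length D + length (S ++ R)          ≡⟨ cong (length D +_) (length-++ S {R}) ⟩
    length D + (length S + length R)    ≡⟨ cong₂ (λ d s → d + (s + length R)) lenD lenS ⟩
    k + (k + length R)                  ∎
  where open ≡-Reasoning

length-Splits : ∀ {S T} → Splits S T → length T ≡ length S + length S
length-Splits [] = refl
length-Splits (_∷_ {xs = S} _ spl) =
  cong suc (trans (cong suc (length-Splits spl)) (sym (+-suc (length S) (length S))))

sum-Splits : ∀ {S T} → Splits S T → sum T ≡ sum S
sum-Splits [] = refl
sum-Splits (_∷_ {a} {b} {ys = T} _ spl) =
  trans (sym (+-assoc a b (sum T))) (cong (a + b +_) (sum-Splits spl))

Splits-pos : ∀ {S T} → Splits S T → All (0 <_) T
Splits-pos [] = []
Splits-pos ((a>0 , b>0) ∷ spl) = a>0 ∷ b>0 ∷ Splits-pos spl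

length≤sum : ∀ {xs} → All (0 <_) xs → length xs ≤ sum xs
length≤sum [] = z≤n
length≤sum (x>0 ∷ xs>0) = +-mono-≤ x>0 (length≤sum xs>0)

module _ {p q : List ℕ} (p→q : Move p q) where
  open Move p→q

  move-preserves-length : length q ≡ length p
  move-preserves-length = begin
    length q                          ≡⟨ ↭-length q-form ⟩
    length (R ++ T)                   ≡⟨ length-++ R ⟩
    length R + length T               ≡⟨ cong (length R +_) (length-Splits splitST) ⟩
    length R + (length S + length S)  ≡⟨ cong (λ s → length R + (s + s)) lenS ⟩
    length R + (k + k)                ≡⟨ +-comm (length R) (k + k) ⟩
    k + k + length R                  ≡⟨ +-assoc k k (length R) ⟩
    k + (k + length R)                ≡⟨ sym (length-arrangement {D = D} {S} {R} p-split lenD lenS) ⟩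
    length p                          ∎
    where open ≡-Reasoning

  move-preserves-pos : All (0 <_) p → All (0 <_) q
  move-preserves-pos p>0 =
    All-resp-↭ (↭-sym q-form)
      (++⁺ (++⁻ʳ S (++⁻ʳ D (All-resp-↭ p-split p>0))) (Splits-pos splitST))

  move-decreases-sum : All (0 <_) p → sum q < sum p
  move-decreases-sum p>0 = begin-strict
    sum q                    ≡⟨ sum-↭ q-form ⟩
    sum (R ++ T)             ≡⟨ sum-++ R T ⟩
    sum R + sum T            ≡⟨ cong (sum R +_) (sum-Splits splitST) ⟩
    sum R + sum S            ≡⟨ +-comm (sum R) (sum S) ⟩
    sum S + sum R            <⟨ m<n+m (sum S + sum R) sumD>0 ⟩
    sum D + (sum S + sum R)  ≡⟨ cong (sum D +_) (sym (sum-++ S R)) ⟩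
    sum D + sum (S ++ R)     ≡⟨ sym (sum-++ D (S ++ R)) ⟩
    sum (D ++ S ++ R)        ≡⟨ sym (sum-↭ p-split) ⟩
    sum p                    ∎
    where
    open ≤-Reasoning
    sumD>0 : 0 < sum D
    sumD>0 =
      ≤-trans k≥1 (subst (_≤ sum D) lenD (length≤sum (++⁻ˡ D (All-resp-↭ p-split p>0))))

move-preserves-Position : ∀ {n p q} → Move p q → Position n p → Position n q
move-preserves-Position p→q (p>0 , lenp) =
  move-preserves-pos p→q p>0 , trans (move-preserves-length p→q) lenp

module _ {n : ℕ} (Good : List ℕ → Set)
  (no-Good-move : ∀ {p q} → Position n p → Good p → Move p q → ¬ Good q)
  (Good-reachable : ∀ {p} → Position n p → ¬ Good p → ∃ λ q → Move p q × Good q) where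

  Good⇒¬Win : ∀ {p} → Position n p → Good p → ¬ Win p
  Good⇒¬Win pos-p good-p (win q p→q q-lost) with move-preserves-Position p→q pos-p
  ... | pos-q with Good-reachable pos-q (no-Good-move pos-p good-p p→q)
  ...   | r , q→r , good-r = Good⇒¬Win (move-preserves-Position q→r pos-q) good-r (q-lost r q→r)

  ¬Good⇒Win : ∀ {p} → Acc _<_ (sum p) → Position n p → ¬ Good p → Win p
  ¬Good⇒Win (acc smaller) pos-p bad-p with Good-reachable pos-p bad-p
  ... | q , p→q , good-q = win q p→q answer
    where
    pos-q : Position n q
    pos-q = move-preserves-Position p→q pos-p
    answer : ∀ r → Move q r → Win r
    answer r q→r = ¬Good⇒Win
      (smaller (<-trans (move-decreases-sum q→r (proj₁ pos-q))
                        (move-decreases-sum p→q (proj₁ pos-p))))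
      (move-preserves-Position q→r pos-q) (no-Good-move pos-q good-q q→r)

  PPosition⇔Good : ∀ {p} → Position n p → Dec (Good p) → PPosition p ⇔ Good p
  PPosition⇔Good pos-p Good? = mk⇔
    (λ ¬win → decidable-stable Good? λ bad → ¬win (¬Good⇒Win (<-wellFounded _) pos-p bad))
    (Good⇒¬Win pos-p)

Splits-breaks-AllV2 : ∀ {t S T} → Splits S T → 1 ≤ length S → AllV2 t S → ¬ AllV2 t T
Splits-breaks-AllV2 {t} (_ ∷ _) _ (v-ab ∷ _) (v-a ∷ v-b ∷ _) =
  proj₂ v-ab (V2-+ {t = t} v-a v-b)

move-breaks-AllV2 : ∀ {t p q} → Move p q → AllV2 t p → ¬ AllV2 t q
move-breaks-AllV2 {t} p→q vp vq = Splits-breaks-AllV2 {t} splitST (subst (1 ≤_) (sym lenS) k≥1)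
  (++⁻ˡ S (++⁻ʳ D (All-resp-↭ p-split vp))) (++⁻ʳ R (All-resp-↭ q-form vq))
  where open Move p→q

odd-move-spares-heap : ∀ {P Q : ℕ → Set} {p q} → ¬ 2 ∣ length p → Move p q → All P p → All Q q →
                       ∃ λ z → P z × Q z
odd-move-spares-heap {P} {Q} {p} odd p→q ap aq =
  spared (length-arrangement {D = D} {S} {R} p-split lenD lenS)
    (++⁻ʳ S (++⁻ʳ D (All-resp-↭ p-split ap))) (++⁻ˡ R (All-resp-↭ q-form aq))
  where
  open Move p→q
  spared : ∀ {R'} → length p ≡ k + (k + length R') → All P R' → All Q R' → ∃ λ z → P z × Q z
  spared {[]}    len _ _ = ⊥-elim (odd (subst (2 ∣_) (sym len) (m∣m*n k)))
  spared {z ∷ _} _ (pz ∷ _) (qz ∷ _) = z , pz , qz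

record MovePlan (t : ℕ) (p : List ℕ) : Set where
  constructor plan
  field
    deleted split kept pieces : List ℕ
    arrangement : p ↭ deleted ++ split ++ kept
    balanced    : length deleted ≡ length split
    splitting   : Splits split pieces
    kept-V2     : AllV2 t kept
    pieces-V2   : AllV2 t pieces

MovePlan-resp-↭ : ∀ {t p p'} → p ↭ p' → MovePlan t p' → MovePlan t p
MovePlan-resp-↭ p↭p' (plan D S R T arr bal spl vR vT) =
  plan D S R T (↭-trans p↭p' arr) bal spl vR vT

keep-all : ∀ {t L} → AllV2 t L → MovePlan t L
keep-all {L = L} vL = plan [] [] L [] ↭-refl refl [] vL []

delete-and-split : ∀ {t x y p} → High t x → MovePlan t p → MovePlan t (x ∷ y ∷ p)
delete-and-split {t} {y = y} {p} hx (plan D S R T arr bal spl vR vT) with split-High hx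
... | a , b , refl , va , vb = plan (y ∷ D) (a + b ∷ S) R (a ∷ b ∷ T) arr' (cong suc bal)
      ((V2⇒>0 {t = t} va , V2⇒>0 {t = t} vb) ∷ spl) vR (va ∷ vb ∷ vT)
  where
  arr' : a + b ∷ y ∷ p ↭ (y ∷ D) ++ (a + b ∷ S) ++ R
  arr' = ↭-trans (swap (a + b) y arr) (prep y (↭-sym (shift (a + b) D (S ++ R))))

MovePlan⇒Move : ∀ {t p} → MovePlan t p → ¬ AllV2 t p → ∃ λ q → Move p q × AllV2 t q
MovePlan⇒Move (plan [] [] R _ arr _ [] vR _) ¬vp = ⊥-elim (¬vp (All-resp-↭ (↭-sym arr) vR))
MovePlan⇒Move {p = p} (plan D S@(_ ∷ _) R T arr bal spl vR vT) _ = R ++ T , p→q , ++⁺ vR vT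
  where
  k = length S
  p→q : Move p (R ++ T)
  p→q = record
    { k = k ; k≥1 = s≤s z≤n
    ; k≤half = subst (2 * k ≤_) (sym (length-arrangement {D = D} {S} {R} arr bal refl))
                 (+-monoʳ-≤ k (+-monoʳ-≤ k z≤n))
    ; D = D ; S = S ; R = R ; T = T ; p-split = arr ; lenD = bal ; lenS = refl
    ; splitST = spl ; q-form = ↭-refl }

Pairable : ℕ → List ℕ → Set
Pairable t xs = Any (λ z → V2 z t) xs ⊎ 2 ∣ length xs

Pairable-resp-↭ : ∀ {t xs ys} → xs ↭ ys → Pairable t xs → Pairable t ys
Pairable-resp-↭ xs↭ys = ⊎-map (Any-resp-↭ xs↭ys) (subst (2 ∣_) (↭-length xs↭ys))

High-¬Pairable : ∀ {t x} → High t x → ¬ Pairable t (x ∷ [])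
High-¬Pairable hx (inj₁ (here vx)) = High⇒¬V2 hx vx
High-¬Pairable _ (inj₂ 2∣1) with ∣1⇒≡1 2∣1
... | ()

Pairable-drop : ∀ {t x y xs} → High t x → High t y → Pairable t (x ∷ y ∷ xs) → Pairable t xs
Pairable-drop hx _  (inj₁ (here vx))         = ⊥-elim (High⇒¬V2 hx vx)
Pairable-drop _  hy (inj₁ (there (here vy))) = ⊥-elim (High⇒¬V2 hy vy)
Pairable-drop _  _  (inj₁ (there (there a))) = inj₁ a
Pairable-drop _  _  (inj₂ 2∣2+n)             = inj₂ (∣m+n∣m⇒∣n 2∣2+n ∣-refl)

plan-pairing : ∀ {t H L} → All (High t) H → AllV2 t L → Pairable t (H ++ L) →
               MovePlan t (H ++ L)
plan-pairing []                     vL       _  = keep-all vL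
plan-pairing {L = []}    (hx ∷ [])  _        pr = ⊥-elim (High-¬Pairable hx pr)
plan-pairing {L = _ ∷ _} (hx ∷ [])  (_ ∷ vL) _  = delete-and-split hx (keep-all vL)
plan-pairing (hx ∷ hy ∷ hH) vL pr = delete-and-split hx (plan-pairing hH vL (Pairable-drop hx hy pr))

partition-High : ∀ {t p} → All (λ z → 2 ^ t ∣ z) p → All (0 <_) p →
                 ∃₂ λ H L → p ↭ H ++ L × All (High t) H × AllV2 t L
partition-High [] [] = [] , [] , ↭-refl , [] , []
partition-High {t} {z ∷ _} (2^t∣z ∷ div) (z>0 ∷ pos)
  with 2 ^ suc t ∣? z | partition-High div pos
... | yes 2^[1+t]∣z | H , L , arr , hH , vL =
  z ∷ H , L , prep z arr , high 2^[1+t]∣z z>0 ∷ hH , vL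
... | no 2^[1+t]∤z  | H , L , arr , hH , vL =
  H , z ∷ L , ↭-trans (prep z arr) (↭-sym (shift z H L)) , hH , (2^t∣z , 2^[1+t]∤z) ∷ vL

move-to-AllV2 : ∀ {t p} → All (λ z → 2 ^ t ∣ z) p → All (0 <_) p → ¬ AllV2 t p → Pairable t p →
                ∃ λ q → Move p q × AllV2 t q
move-to-AllV2 {t} div pos ¬vp pr with partition-High {t} div pos
... | H , L , arr , hH , vL =
  MovePlan⇒Move (MovePlan-resp-↭ arr (plan-pairing hH vL (Pairable-resp-↭ {t} arr pr))) ¬vp

minimal-V2 : ∀ {z p} → All (0 <_) (z ∷ p) →
             ∃ λ t → All (λ w → 2 ^ t ∣ w) (z ∷ p) × Any (λ w → V2 w t) (z ∷ p)
minimal-V2 (z>0 ∷ []) with v2-exists z>0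
... | t , vz = t , proj₁ vz ∷ [] , here vz
minimal-V2 (z>0 ∷ pos@(_ ∷ _)) with v2-exists z>0 | minimal-V2 pos
... | s , vz | t , div , low with s ≤? t
...   | yes s≤t = s , proj₁ vz ∷ All-map (∣-trans (^-monoʳ-∣ 2 s≤t)) div , here vz
...   | no  s≰t = t , ∣-trans (^-monoʳ-∣ 2 (≰⇒≥ s≰t)) (proj₁ vz) ∷ div , there low

∃AllV2? : ∀ {p} → All (0 <_) p → Dec (∃ λ t → AllV2 t p)
∃AllV2? [] = yes (0 , [])
∃AllV2? {z ∷ p} (z>0 ∷ _) with v2-exists z>0
... | t , vz with all? (λ w → V2? w t) (z ∷ p)
...   | yes vp = yes (t , vp)
...   | no ¬vp = no λ where
        (s , vs ∷ vp) →
          ¬vp (subst (λ s → AllV2 s (z ∷ p)) (V2-unique {s = s} {t} vs vz) (vs ∷ vp))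

PPosition⇔AllV2-zero : ∀ {n p} → 2 ∣ n → Position n p → PPosition p ⇔ AllV2 0 p
PPosition⇔AllV2-zero {p = p} 2∣n pos-p = PPosition⇔Good (AllV2 0)
  (λ _ vp p→q vq → move-breaks-AllV2 {0} p→q vp vq)
  (λ { (q>0 , lenq) ¬vq → move-to-AllV2 {0} (All-map (λ {z} _ → 1∣ z) q>0) q>0 ¬vq
         (inj₂ (subst (2 ∣_) (sym lenq) 2∣n)) })
  pos-p (all? (λ z → V2? z 0) p)

PPosition⇔∃AllV2 : ∀ {n p} → ¬ 2 ∣ n → Position n p → PPosition p ⇔ (∃ λ t → AllV2 t p)
PPosition⇔∃AllV2 {n} 2∤n pos-p = PPosition⇔Good (λ q → ∃ λ t → AllV2 t q)
  no-move reachable pos-p (∃AllV2? (proj₁ pos-p))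
  where
  no-move : ∀ {q r} → Position n q → ∃ (λ t → AllV2 t q) → Move q r → ¬ ∃ λ t → AllV2 t r
  no-move (_ , lenq) (s , vq) q→r (t , vr)
    with odd-move-spares-heap {λ z → V2 z s} {λ z → V2 z t}
           (λ 2∣len → 2∤n (subst (2 ∣_) lenq 2∣len)) q→r vq vr
  ... | _ , vs , vt rewrite V2-unique {s = s} {t} vs vt = move-breaks-AllV2 {t} q→r vq vr
  reachable : ∀ {q} → Position n q → ¬ ∃ (λ t → AllV2 t q) → ∃ λ r → Move q r × ∃ λ t → AllV2 t r
  reachable {[]} (_ , refl) _ = ⊥-elim (2∤n (2 ∣0))
  reachable {_ ∷ _} (q>0 , _) ¬vq with minimal-V2 q>0
  ... | t , div , low with move-to-AllV2 {t} div q>0 (λ vq → ¬vq (t , vq)) (inj₁ low)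
  ...   | r , q→r , vr = r , q→r , t , vr

theorem4p2 : (zs : List ℕ) → 2 ≤ length zs → All (0 <_) zs →
    ((2 ∣ length zs) → (PPosition zs ⇔ All (λ z → V2 z 0) zs))
    × (¬ (2 ∣ length zs) → (PPosition zs ⇔ ∃ λ k → All (λ z → V2 z k) zs))
theorem4p2 zs _ zs>0 =
    (λ 2∣n → PPosition⇔AllV2-zero 2∣n (zs>0 , refl))
  , (λ 2∤n → PPosition⇔∃AllV2 2∤n (zs>0 , refl))
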